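{- Let $L$ be a planar triangulation with $n_L\ge 3$ vertices, let $H$ be its planar conjugated triangulation with edges $e_1,\dots,e_{m_H}$, and orient every edge of $H$ in the direction in which it is traversed by a fixed Eulerian circuit of $H$. Let $R=(r_{ij})$ be the $m_H\times m_H$ $0$–$1$ matrix with $r_{ij}=1$ if and only if the head of $e_i$ equals the tail of $e_j$. Then $\sum_{i=1}^{m_H}\sum_{j=1}^{m_H} r_{ij}=4k$ for some integer $k\ge 3$.
   Context: A planar triangulation is a maximal planar simple graph, embedded in the plane so that every face (including the unbounded one) is a triangle. The planar conjugated triangulation $H$ of $L$ is the plane (multi)graph whose vertices are the midpoints of the edges of $L$, and in which, for every face of $L$, including the unbounded one, the three midpoints of its boundary edges are joined pairwise by three curves drawn inside that face (the medial graph of $L$); every vertex of $H$ has degree $4$, so $H$ has an Eulerian circuit. -}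

module Defs where

open import Data.Nat using (ℕ; zero; suc; _+_; _*_; _≤_; _≤ᵇ_)
open import Data.Bool using (Bool; true; false; if_then_else_) renaming (_≟_ to _≟ᵇ_)
open import Data.Fin using (Fin; toℕ) renaming (_≟_ to _≟ᶠ_; zero to fzero; suc to fsuc)
open import Data.Fin.Permutation using (Permutation′; _⟨$⟩ʳ_)
open import Data.List using (List; []; _∷_; upTo; allFin; filter; length)
open import Data.Product using (∃-syntax; _×_)
open import Data.Sum using (_⊎_; inj₁; inj₂)
open import Relation.Nullary using (¬_; Dec; yes; no)
open import Relation.Binary.PropositionalEquality using (_≡_)

∑ : (n : ℕ) → (Fin n → ℕ) → ℕ
∑ zero    f = 0
∑ (suc n) f = f fzero + ∑ n (λ i → f (fsuc i))

iter : {d : ℕ} → (Fin d → Fin d) → ℕ → Fin d → Fin d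
iter p zero    x = x
iter p (suc k) x = p (iter p k x)

SameOrbit : {d : ℕ} → (Fin d → Fin d) → Fin d → Fin d → Set
SameOrbit p x y = ∃[ k ] (iter p k x ≡ y)

allB : {A : Set} → (A → Bool) → List A → Bool
allB p []       = true
allB p (a ∷ as) = if p a then allB p as else false

-- x is the (numerically) least element of its p-orbit
-- (an orbit of a permutation of Fin d has at most d elements)
isOrbitRep : {d : ℕ} → (Fin d → Fin d) → Fin d → Bool
isOrbitRep {d} p x = allB (λ k → toℕ x ≤ᵇ toℕ (iter p k x)) (upTo d)

numOrbits : {d : ℕ} → (Fin d → Fin d) → ℕ
numOrbits {d} p = length (filter (λ x → isOrbitRep p x ≟ᵇ true) (allFin d))

-- Combinatorial maps (rotation systems) on the dart set Fin d.
-- σ : rotation of darts around vertices (vertices = σ-cycles)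
-- α : edge involution (edges = α-orbits {x , α x})
-- φ = σ ∘ α : face permutation (faces = φ-cycles)

record CombMap (d : ℕ) : Set where
  field
    σ : Permutation′ d
    α : Permutation′ d

  σf : Fin d → Fin d
  σf x = σ ⟨$⟩ʳ x

  αf : Fin d → Fin d
  αf x = α ⟨$⟩ʳ x

  φf : Fin d → Fin d
  φf x = σf (αf x)

  numVertices : ℕ
  numVertices = numOrbits σf

  numEdges : ℕ
  numEdges = numOrbits αf

  numFaces : ℕ
  numFaces = numOrbits φf

  SameEdge : Fin d → Fin d → Set
  SameEdge x y = (x ≡ y) ⊎ (x ≡ αf y)

open CombMap public

data Connected {d : ℕ} (M : CombMap d) : Fin d → Fin d → Set where
  here  : ∀ {x} → Connected M x x
  viaσ  : ∀ {x y} → Connected M (σf M x) y → Connected M x y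
  viaα  : ∀ {x y} → Connected M (αf M x) y → Connected M x y

-- A planar triangulation: a connected combinatorial map of genus 0
-- (Euler's formula V - E + F = 2) whose underlying graph is simple
-- and all of whose faces (incl. the outer one) are triangles.
record PlanarTriangulation {d : ℕ} (M : CombMap d) : Set where
  field
    α-involution   : ∀ x → αf M (αf M x) ≡ x
    α-fixpointFree : ∀ x → ¬ (αf M x ≡ x)
    connected      : ∀ x y → Connected M x y
    euler          : numVertices M + numFaces M ≡ numEdges M + 2
    triangular     : ∀ x → iter (φf M) 3 x ≡ x
    faceNonTrivial : ∀ x → ¬ (φf M x ≡ x)
    noLoops        : ∀ x → ¬ SameOrbit (σf M) x (αf M x)
    noMultiEdges   : ∀ x y → SameOrbit (σf M) x y →
                     SameOrbit (σf M) (αf M x) (αf M y) → x ≡ y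

-- The conjugated triangulation (medial graph) H of L.
-- Vertices of H = edges of L (represented by darts, up to SameEdge).
-- Edges of H = darts x of L: the curve inside the face of x joining the
-- midpoint of the edge of x to the midpoint of the edge of φ x.
-- An orientation o : Fin d → Bool orients curve x from edge(x) to
-- edge(φ x) when o x = true, and the other way round otherwise.

tailH : {d : ℕ} → CombMap d → (Fin d → Bool) → Fin d → Fin d
tailH M o x = if o x then x else φf M x

headH : {d : ℕ} → CombMap d → (Fin d → Bool) → Fin d → Fin d
headH M o x = if o x then φf M x else x

-- An Eulerian circuit of H traversing each edge x of H from tailH to
-- headH: given as the cyclic successor ν on the edges of H, which is a
-- single cycle through all edges, with head of x = tail of ν x.
record EulerianCircuit {d : ℕ} (M : CombMap d) (o : Fin d → Bool)
                       (ν : Permutation′ d) : Set where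
  field
    singleCycle : ∀ x y → SameOrbit (ν ⟨$⟩ʳ_) x y
    consecutive : ∀ x → SameEdge M (headH M o x) (tailH M o (ν ⟨$⟩ʳ x))

sameEdge? : {d : ℕ} (M : CombMap d) → ∀ x y → Dec (SameEdge M x y)
sameEdge? M x y with x ≟ᶠ y | x ≟ᶠ αf M y
... | yes p | _     = yes (inj₁ p)
... | no _  | yes q = yes (inj₂ q)
... | no p  | no q  = no λ { (inj₁ r) → p r ; (inj₂ r) → q r }

Rmat : {d : ℕ} → CombMap d → (Fin d → Bool) → Fin d → Fin d → ℕ
Rmat M o i j with sameEdge? M (headH M o i) (tailH M o j)
... | yes _ = 1
... | no _  = 0

sumR : {d : ℕ} → CombMap d → (Fin d → Bool) → ℕ
sumR {d} M o = ∑ d (λ i → ∑ d (λ j → Rmat M o i j))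

-- Row i of R counts the edges of H leaving the head of e_i.  Since the
-- orientation comes from an Eulerian circuit, every vertex of the 4-regular
-- graph H has in-degree = out-degree = 2, so the entries of R add up to
-- 2 m_H.  The edges of H are the darts of L, which split into pairs (the
-- edges of L) and into triples (the triangular faces of L); hence
-- m_H = 2 m_L = 3 f_L, the sum is 4 m_L, and m_L ≥ 3 because m_H ≥ n_L ≥ 3
-- is a multiple of 6.
module Submission where

open import Defs
open import Data.Nat using (ℕ; zero; suc; _+_; _*_; _≤_; z≤n; s≤s)
open import Data.Nat.Properties
  using (+-comm; +-identityʳ; *-zeroʳ; *-identityʳ; *-comm; *-assoc; *-cancelˡ-≡; ≤-trans; ≤-reflexive; +-*-semiring)
open import Data.Nat.Divisibility using (divides; _∣?_)
open import Data.Bool using (Bool; true; false)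
open import Data.Fin using (Fin; toℕ; _<_) renaming (zero to fzero; suc to fsuc)
open import Data.Fin.Properties using (_≟_; _<?_; <-cmp; <-asym; <-trans; suc-injective)
open import Data.Fin.Permutation using (Permutation′; _⟨$⟩ʳ_; _∘ₚ_)
open import Data.List using (allFin)
open import Data.List.Properties using (length-filter; length-tabulate)
open import Data.Product using (∃-syntax; _×_; _,_)
open import Data.Sum using (inj₁; inj₂)
open import Data.Empty using (⊥-elim)
open import Function using (_∘_; id)
open import Relation.Binary using (tri<; tri≈; tri>)
open import Relation.Binary.PropositionalEquality using (_≡_; _≢_; refl; sym; trans; cong; cong₂; module ≡-Reasoning)
open import Relation.Nullary using (¬_; Dec; yes; no)
open import Relation.Nullary.Decidable using (from-no)
open import Algebra.Properties.Semiring.Sum +-*-semiring using (sum; ∑-distrib-+; sum-permute)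

open ≡-Reasoning

∑≡sum : ∀ n (f : Fin n → ℕ) → ∑ n f ≡ sum f
∑≡sum zero    f = refl
∑≡sum (suc n) f = cong (f fzero +_) (∑≡sum n (f ∘ fsuc))

∑-cong : ∀ n {f g : Fin n → ℕ} → (∀ i → f i ≡ g i) → ∑ n f ≡ ∑ n g
∑-cong zero    f≗g = refl
∑-cong (suc n) f≗g = cong₂ _+_ (f≗g fzero) (∑-cong n (f≗g ∘ fsuc))

∑-const : ∀ n c → ∑ n (λ _ → c) ≡ n * c
∑-const zero    c = refl
∑-const (suc n) c = cong (c +_) (∑-const n c)

∑-+ : ∀ n (f g : Fin n → ℕ) → ∑ n (λ i → f i + g i) ≡ ∑ n f + ∑ n g
∑-+ n f g = trans (∑≡sum n _)
                  (trans (∑-distrib-+ f g) (sym (cong₂ _+_ (∑≡sum n f) (∑≡sum n g))))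

∑-comm : ∀ m n (f : Fin m → Fin n → ℕ) →
         ∑ m (λ i → ∑ n (f i)) ≡ ∑ n (λ j → ∑ m (λ i → f i j))
∑-comm zero    n f = sym (trans (∑-const n 0) (*-zeroʳ n))
∑-comm (suc m) n f = trans (cong (∑ n (f fzero) +_) (∑-comm m n (f ∘ fsuc)))
                           (sym (∑-+ n (f fzero) _))

∑-permute : ∀ {n} (π : Permutation′ n) (f : Fin n → ℕ) → ∑ n (λ i → f (π ⟨$⟩ʳ i)) ≡ ∑ n f
∑-permute {n} π f = trans (∑≡sum n _) (trans (sym (sum-permute f π)) (sym (∑≡sum n f)))

∑-iter : ∀ {n} (π : Permutation′ n) (f : Fin n → ℕ) k →
         ∑ n (λ x → f (iter (π ⟨$⟩ʳ_) k x)) ≡ ∑ n f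
∑-iter π f zero    = refl
∑-iter π f (suc k) = trans (∑-iter π (f ∘ (π ⟨$⟩ʳ_)) k) (∑-permute π f)

-- Double counting: Σₓ Σₖ f (πᵏ x) is n by hypothesis, and m · Σ f because
-- every πᵏ permutes Fin n.
∑-transversal : ∀ {n} (π : Permutation′ n) m (f : Fin n → ℕ) →
                (∀ x → ∑ m (λ k → f (iter (π ⟨$⟩ʳ_) (toℕ k) x)) ≡ 1) →
                n ≡ m * ∑ n f
∑-transversal {n} π m f once = begin
  n
    ≡⟨ sym (*-identityʳ n) ⟩
  n * 1
    ≡⟨ sym (∑-const n 1) ⟩
  ∑ n (λ _ → 1)
    ≡⟨ ∑-cong n (sym ∘ once) ⟩
  ∑ n (λ x → ∑ m (λ k → f (iter (π ⟨$⟩ʳ_) (toℕ k) x)))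
    ≡⟨ ∑-comm n m _ ⟩
  ∑ m (λ k → ∑ n (λ x → f (iter (π ⟨$⟩ʳ_) (toℕ k) x)))
    ≡⟨ ∑-cong m (∑-iter π f ∘ toℕ) ⟩
  ∑ m (λ _ → ∑ n f)
    ≡⟨ ∑-const m _ ⟩
  m * ∑ n f ∎

𝟙 : {P : Set} → Dec P → ℕ
𝟙 (yes _) = 1
𝟙 (no _)  = 0

𝟙-yes : {P : Set} → P → (p? : Dec P) → 𝟙 p? ≡ 1
𝟙-yes p (yes _) = refl
𝟙-yes p (no ¬p) = ⊥-elim (¬p p)

𝟙-no : {P : Set} → ¬ P → (p? : Dec P) → 𝟙 p? ≡ 0
𝟙-no ¬p (yes p) = ⊥-elim (¬p p)
𝟙-no ¬p (no _)  = refl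

𝟙-cong : {P Q : Set} → (P → Q) → (Q → P) → (p? : Dec P) (q? : Dec Q) → 𝟙 p? ≡ 𝟙 q?
𝟙-cong P→Q Q→P (yes p) q? = sym (𝟙-yes (P→Q p) q?)
𝟙-cong P→Q Q→P (no ¬p) q? = sym (𝟙-no (¬p ∘ Q→P) q?)

∑-𝟙-≡ : ∀ {n} (z : Fin n) → ∑ n (λ y → 𝟙 (z ≟ y)) ≡ 1
∑-𝟙-≡ {suc n} fzero = cong₂ _+_ (𝟙-yes refl (fzero {n} ≟ fzero))
  (trans (∑-cong n (λ y → 𝟙-no (λ ()) (fzero ≟ fsuc y))) (trans (∑-const n 0) (*-zeroʳ n)))
∑-𝟙-≡ {suc n} (fsuc z) = cong₂ _+_ (𝟙-no (λ ()) (fsuc z ≟ fzero))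
  (trans (∑-cong n (λ y → 𝟙-cong suc-injective (cong fsuc) (fsuc z ≟ fsuc y) (z ≟ y))) (∑-𝟙-≡ z))

[_<_] : ∀ {n} → Fin n → Fin n → ℕ
[ a < b ] = 𝟙 (a <? b)

[<]-true : ∀ {n} {a b : Fin n} → a < b → [ a < b ] ≡ 1
[<]-true {a = a} {b} a<b = 𝟙-yes a<b (a <? b)

[<]-false : ∀ {n} {a b : Fin n} → b < a → [ a < b ] ≡ 0
[<]-false {a = a} {b} b<a = 𝟙-no (<-asym b<a) (a <? b)

least-of-two : ∀ {n} (a b : Fin n) → a ≢ b → [ a < b ] + [ b < a ] ≡ 1
least-of-two a b a≢b with <-cmp a b
... | tri< a<b _ _ = cong₂ _+_ ([<]-true a<b) ([<]-false a<b)
... | tri≈ _ a≡b _ = ⊥-elim (a≢b a≡b)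
... | tri> _ _ b<a = cong₂ _+_ ([<]-false b<a) ([<]-true b<a)

leastCount : ∀ {n} → Fin n → Fin n → Fin n → ℕ
leastCount a b c = [ a < b ] * [ a < c ] + ([ b < c ] * [ b < a ] + [ c < a ] * [ c < b ])

leastCount-values : ∀ {n} {a b c : Fin n} {p q r s t u} →
  [ a < b ] ≡ p → [ a < c ] ≡ q → [ b < c ] ≡ r → [ b < a ] ≡ s → [ c < a ] ≡ t → [ c < b ] ≡ u →
  leastCount a b c ≡ p * q + (r * s + t * u)
leastCount-values refl refl refl refl refl refl = refl

least-of-three : ∀ {n} (a b c : Fin n) → a ≢ b → b ≢ c → a ≢ c → leastCount a b c ≡ 1
least-of-three a b c a≢b b≢c a≢c with <-cmp a b | <-cmp b c | <-cmp a c
... | tri≈ _ a≡b _ | _ | _ = ⊥-elim (a≢b a≡b)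
... | _ | tri≈ _ b≡c _ | _ = ⊥-elim (b≢c b≡c)
... | _ | _ | tri≈ _ a≡c _ = ⊥-elim (a≢c a≡c)
... | tri< a<b _ _ | tri< b<c _ _ | tri> _ _ c<a = ⊥-elim (<-asym (<-trans a<b b<c) c<a)
... | tri> _ _ b<a | tri> _ _ c<b | tri< a<c _ _ = ⊥-elim (<-asym (<-trans c<b b<a) a<c)
... | tri< a<b _ _ | tri< b<c _ _ | tri< a<c _ _ = leastCount-values
  ([<]-true a<b) ([<]-true a<c) ([<]-true b<c) ([<]-false a<b) ([<]-false a<c) ([<]-false b<c)
... | tri< a<b _ _ | tri> _ _ c<b | tri< a<c _ _ = leastCount-values
  ([<]-true a<b) ([<]-true a<c) ([<]-false c<b) ([<]-false a<b) ([<]-false a<c) ([<]-true c<b)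
... | tri< a<b _ _ | tri> _ _ c<b | tri> _ _ c<a = leastCount-values
  ([<]-true a<b) ([<]-false c<a) ([<]-false c<b) ([<]-false a<b) ([<]-true c<a) ([<]-true c<b)
... | tri> _ _ b<a | tri< b<c _ _ | tri< a<c _ _ = leastCount-values
  ([<]-false b<a) ([<]-true a<c) ([<]-true b<c) ([<]-true b<a) ([<]-false a<c) ([<]-false b<c)
... | tri> _ _ b<a | tri< b<c _ _ | tri> _ _ c<a = leastCount-values
  ([<]-false b<a) ([<]-false c<a) ([<]-true b<c) ([<]-true b<a) ([<]-true c<a) ([<]-false b<c)
... | tri> _ _ b<a | tri> _ _ c<b | tri> _ _ c<a = leastCount-values
  ([<]-false b<a) ([<]-false c<a) ([<]-false c<b) ([<]-true b<a) ([<]-true c<a) ([<]-true c<b)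

numOrbits≤ : ∀ {n} (p : Fin n → Fin n) → numOrbits p ≤ n
numOrbits≤ {n} p = ≤-trans (length-filter _ (allFin n)) (≤-reflexive (length-tabulate id))

3≤half-of-multiple-of-six : ∀ {n} e f → n ≡ 2 * e → n ≡ 3 * f → 3 ≤ n → 3 ≤ e
3≤half-of-multiple-of-six 0 f refl _ ()
3≤half-of-multiple-of-six 1 f refl _ (s≤s (s≤s ()))
3≤half-of-multiple-of-six 2 f refl 4≡3f _ = ⊥-elim (from-no (3 ∣? 4) (divides f (trans 4≡3f (*-comm 3 f))))
3≤half-of-multiple-of-six (suc (suc (suc e))) f _ _ _ = s≤s (s≤s (s≤s z≤n))

module _ {d : ℕ} (L : CombMap d) (PT : PlanarTriangulation L) where
  open PlanarTriangulation PT

  φ-permutation : Permutation′ d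
  φ-permutation = α L ∘ₚ σ L

  -- a dart represents its edge (face) iff it is the least dart of that edge (face)
  edgeRep : Fin d → ℕ
  edgeRep x = [ x < αf L x ]

  faceRep : Fin d → ℕ
  faceRep x = [ x < φf L x ] * [ x < φf L (φf L x) ]

  darts≡2*edges : d ≡ 2 * ∑ d edgeRep
  darts≡2*edges = ∑-transversal (α L) 2 edgeRep λ x → begin
    edgeRep x + (edgeRep (αf L x) + 0)
      ≡⟨ cong (edgeRep x +_) (+-identityʳ _) ⟩
    [ x < αf L x ] + [ αf L x < αf L (αf L x) ]
      ≡⟨ cong (λ y → [ x < αf L x ] + [ αf L x < y ]) (α-involution x) ⟩
    [ x < αf L x ] + [ αf L x < x ]
      ≡⟨ least-of-two x (αf L x) (α-fixpointFree x ∘ sym) ⟩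
    1 ∎

  darts≡3*faces : d ≡ 3 * ∑ d faceRep
  darts≡3*faces = ∑-transversal φ-permutation 3 faceRep λ x → begin
    faceRep x + (faceRep (φ x) + (faceRep (φ² x) + 0))
      ≡⟨ cong (λ s → faceRep x + (faceRep (φ x) + s)) (+-identityʳ _) ⟩
    faceRep x + ([ φ x < φ² x ] * [ φ x < φ (φ² x) ] + [ φ² x < φ (φ² x) ] * [ φ² x < φ (φ (φ² x)) ])
      ≡⟨ cong₂ (λ y z → faceRep x + ([ φ x < φ² x ] * [ φ x < y ] + [ φ² x < y ] * [ φ² x < z ]))
               (triangular x) (cong φ (triangular x)) ⟩
    faceRep x + ([ φ x < φ² x ] * [ φ x < x ] + [ φ² x < x ] * [ φ² x < φ x ])
      ≡⟨ least-of-three x (φ x) (φ² x) (faceNonTrivial x ∘ sym) (faceNonTrivial (φ x) ∘ sym)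
                        (λ x≡φ²x → faceNonTrivial x (trans (cong φ x≡φ²x) (triangular x))) ⟩
    1 ∎
    where
    φ φ² : Fin d → Fin d
    φ = φf L
    φ² = φ ∘ φ

  sameEdge-sym : ∀ {x y} → SameEdge L x y → SameEdge L y x
  sameEdge-sym (inj₁ refl) = inj₁ refl
  sameEdge-sym {y = y} (inj₂ refl) = inj₂ (sym (α-involution y))

  sameEdge-trans : ∀ {x y z} → SameEdge L x y → SameEdge L y z → SameEdge L x z
  sameEdge-trans (inj₁ refl) y~z = y~z
  sameEdge-trans (inj₂ refl) (inj₁ refl) = inj₂ refl
  sameEdge-trans {z = z} (inj₂ refl) (inj₂ refl) = inj₁ (α-involution z)

  module _ (o : Fin d → Bool) (ν : Permutation′ d) (EC : EulerianCircuit L o ν) where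
    open EulerianCircuit EC

    [_~_] : Fin d → Fin d → ℕ
    [ x ~ y ] = 𝟙 (sameEdge? L x y)

    [~]-respects : ∀ {x y} z → SameEdge L x y → [ z ~ x ] ≡ [ z ~ y ]
    [~]-respects z x~y =
      𝟙-cong (λ z~x → sameEdge-trans z~x x~y) (λ z~y → sameEdge-trans z~y (sameEdge-sym x~y)) _ _

    [~]-split : ∀ z y → [ z ~ y ] ≡ 𝟙 (z ≟ y) + 𝟙 (z ≟ αf L y)
    [~]-split z y = split (z ≟ y) (z ≟ αf L y)
      where
      split : (z≟y : Dec (z ≡ y)) (z≟αy : Dec (z ≡ αf L y)) → [ z ~ y ] ≡ 𝟙 z≟y + 𝟙 z≟αy
      split (yes z≡y) (yes z≡αy) = ⊥-elim (α-fixpointFree y (sym (trans (sym z≡y) z≡αy)))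
      split (yes z≡y) (no _)     = 𝟙-yes (inj₁ z≡y) (sameEdge? L z y)
      split (no _)    (yes z≡αy) = 𝟙-yes (inj₂ z≡αy) (sameEdge? L z y)
      split (no z≢y)  (no z≢αy)  = 𝟙-no (λ { (inj₁ z≡y) → z≢y z≡y ; (inj₂ z≡αy) → z≢αy z≡αy }) (sameEdge? L z y)

    ∑-[~] : ∀ z → ∑ d (λ y → [ z ~ y ]) ≡ 2
    ∑-[~] z = begin
      ∑ d (λ y → [ z ~ y ])
        ≡⟨ ∑-cong d ([~]-split z) ⟩
      ∑ d (λ y → 𝟙 (z ≟ y) + 𝟙 (z ≟ αf L y))
        ≡⟨ ∑-+ d _ _ ⟩
      ∑ d (λ y → 𝟙 (z ≟ y)) + ∑ d (λ y → 𝟙 (z ≟ αf L y))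
        ≡⟨ cong₂ _+_ (∑-𝟙-≡ z) (trans (∑-permute (α L) _) (∑-𝟙-≡ z)) ⟩
      2 ∎

    head+tail : ∀ z j → [ z ~ headH L o j ] + [ z ~ tailH L o j ] ≡ [ z ~ j ] + [ z ~ φf L j ]
    head+tail z j with o j
    ... | true  = +-comm [ z ~ φf L j ] [ z ~ j ]
    ... | false = refl

    in-degree≡out-degree : ∀ z → ∑ d (λ j → [ z ~ headH L o j ]) ≡ ∑ d (λ j → [ z ~ tailH L o j ])
    in-degree≡out-degree z = trans (∑-cong d (λ j → [~]-respects z (consecutive j)))
                                   (∑-permute ν (λ j → [ z ~ tailH L o j ]))

    out-degree≡2 : ∀ z → ∑ d (λ j → [ z ~ tailH L o j ]) ≡ 2
    out-degree≡2 z = *-cancelˡ-≡ _ 2 2 (begin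
      out + (out + 0)
        ≡⟨ cong₂ _+_ (sym (in-degree≡out-degree z)) (+-identityʳ out) ⟩
      ∑ d (λ j → [ z ~ headH L o j ]) + out
        ≡⟨ sym (∑-+ d _ _) ⟩
      ∑ d (λ j → [ z ~ headH L o j ] + [ z ~ tailH L o j ])
        ≡⟨ ∑-cong d (head+tail z) ⟩
      ∑ d (λ j → [ z ~ j ] + [ z ~ φf L j ])
        ≡⟨ ∑-+ d _ _ ⟩
      ∑ d (λ j → [ z ~ j ]) + ∑ d (λ j → [ z ~ φf L j ])
        ≡⟨ cong₂ _+_ (∑-[~] z) (trans (∑-permute φ-permutation _) (∑-[~] z)) ⟩
      4 ∎)
      where
      out : ℕ
      out = ∑ d (λ j → [ z ~ tailH L o j ])

    Rmat≡[~] : ∀ i j → Rmat L o i j ≡ [ headH L o i ~ tailH L o j ]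
    Rmat≡[~] i j with sameEdge? L (headH L o i) (tailH L o j)
    ... | yes _ = refl
    ... | no _  = refl

    sumR≡darts*2 : sumR L o ≡ d * 2
    sumR≡darts*2 = trans (∑-cong d (λ i → trans (∑-cong d (Rmat≡[~] i)) (out-degree≡2 (headH L o i))))
                         (∑-const d 2)

corollary9 : (d : ℕ) (L : CombMap d) → PlanarTriangulation L →
             3 ≤ numVertices L →
             (o : Fin d → Bool) (ν : Permutation′ d) → EulerianCircuit L o ν →
             ∃[ k ] (3 ≤ k × sumR L o ≡ 4 * k)
corollary9 d L PT 3≤vertices o ν EC = edges , 3≤edges , sumR≡4*edges
  where
  edges : ℕ
  edges = ∑ d (edgeRep L PT)

  3≤edges : 3 ≤ edges
  3≤edges = 3≤half-of-multiple-of-six edges (∑ d (faceRep L PT))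
              (darts≡2*edges L PT) (darts≡3*faces L PT) (≤-trans 3≤vertices (numOrbits≤ (σf L)))

  sumR≡4*edges : sumR L o ≡ 4 * edges
  sumR≡4*edges = begin
    sumR L o        ≡⟨ sumR≡darts*2 L PT o ν EC ⟩
    d * 2           ≡⟨ cong (_* 2) (darts≡2*edges L PT) ⟩
    2 * edges * 2   ≡⟨ *-comm (2 * edges) 2 ⟩
    2 * (2 * edges) ≡⟨ sym (*-assoc 2 2 edges) ⟩
    4 * edges       ∎
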